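{- Let $D=(V,E)$ be a digraph and $e\in E$ an arc of $D$. Then \[ \pi(D)= \begin{cases} \pi(D_{ -e}) & \text{if } e \text{ is a loop},\\ \pi(D_{ -e})+x\,\pi(D_{/e})-x\,\pi(D_{\dagger e})+x & \text{if } e \text{ is not a loop}. \end{cases} \]
   Context: Digraphs are finite directed multigraphs; loops and multiple arcs are allowed. A directed path of length $k\ge 1$ consists of $k+1$ distinct vertices $v_0,\dots,v_k$ together with arcs $(v_0,v_1),\dots,(v_{k-1},v_k)$. Paths are counted as sets of arcs, so parallel arcs give different paths, and single vertices are not paths. The path polynomial is $\pi(D)=\pi(D;x)=\sum_{k=1}^{|V|-1}p_k(D)x^k$, where $p_k(D)$ is the number of directed paths of length $k$ in $D$. The arc operations are as follows. $D_{ -e}$ is obtained by deleting the arc $e$. If $e=(u,v)$ with $u\ne v$, then $D_{/e}$ is obtained from $D$ by removing all arcs with tail $u$ and all arcs with head $v$ (this includes $e$), and then identifying $u$ and $v$ into one new vertex. If $e=(u,u)$ is a loop, then $D_{/e}$ is obtained by deleting $u$ and its incident arcs. For $e=(u,v)$, $D_{\dagger e}$ is obtained by deleting $u$ and $v$ and all arcs incident to them. -}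

module Defs where

open import Data.Nat using (ℕ; zero; suc)
open import Data.Integer using (ℤ; +_; _+_; _-_)
open import Data.Fin using (Fin; zero; suc; punchOut; _≟_)
open import Data.Product using (_×_; _,_; proj₁; proj₂)
open import Data.Maybe using (Maybe; just; nothing)
open import Data.List using (List; []; _∷_; [_]; length; lookup; removeAt; mapMaybe; filter; map; concatMap; allFin)
open import Data.Vec using (Vec; []; _∷_; toList)
import Data.Vec as Vec
open import Data.Unit using (⊤; tt)
open import Data.Empty using (⊥)
open import Relation.Nullary using (¬_; Dec; yes; no)
open import Relation.Nullary.Decidable using (_×-dec_)
open import Relation.Binary.PropositionalEquality using (_≡_; _≢_; refl; sym)
open import Data.List.Relation.Unary.Unique.Propositional using (Unique)
import Data.List.Relation.Unary.Unique.DecPropositional as UDec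

-- Vertex set Fin nV; the arcs
-- form a list of (tail , head) pairs; an arc is identified by its index
-- in that list, so parallel arcs are distinct arcs.

record Digraph : Set where
  constructor digraph
  field
    nV   : ℕ
    arcs : List (Fin nV × Fin nV)
open Digraph public

Arc : Digraph → Set
Arc D = Fin (length (arcs D))

tl : (D : Digraph) → Arc D → Fin (nV D)
tl D e = proj₁ (lookup (arcs D) e)

hd : (D : Digraph) → Arc D → Fin (nV D)
hd D e = proj₂ (lookup (arcs D) e)

IsLoop : (D : Digraph) → Arc D → Set
IsLoop D e = tl D e ≡ hd D e

-- A path of length k ≥ 1 is a sequence of k arcs
-- e₁,…,e_k with head(eᵢ) = tail(eᵢ₊₁), whose vertex sequence
-- tail(e₁), head(e₁), …, head(e_k) consists of k+1 distinct vertices.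
-- (Paths are counted as arc sequences, so parallel arcs give different
-- paths.)

Linked : (D : Digraph) → ∀ {k} → Vec (Arc D) k → Set
Linked D []           = ⊤
Linked D (e ∷ [])     = ⊤
Linked D (e ∷ f ∷ es) = (hd D e ≡ tl D f) × Linked D (f ∷ es)

linked? : (D : Digraph) → ∀ {k} → (es : Vec (Arc D) k) → Dec (Linked D es)
linked? D []           = yes tt
linked? D (e ∷ [])     = yes tt
linked? D (e ∷ f ∷ es) = (hd D e ≟ tl D f) ×-dec linked? D (f ∷ es)

IsPath : (D : Digraph) → ∀ {k} → Vec (Arc D) k → Set
IsPath D []       = ⊥
IsPath D (e ∷ es) = Linked D (e ∷ es) × Unique (tl D e ∷ toList (Vec.map (hd D) (e ∷ es)))

isPath? : (D : Digraph) → ∀ {k} → (es : Vec (Arc D) k) → Dec (IsPath D es)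
isPath? D []       = no (λ ())
isPath? D (e ∷ es) = linked? D (e ∷ es) ×-dec UDec.unique? (_≟_ {nV D}) (tl D e ∷ toList (Vec.map (hd D) (e ∷ es)))

allVecs : (m k : ℕ) → List (Vec (Fin m) k)
allVecs m zero    = [ [] ]
allVecs m (suc k) = concatMap (λ e → map (e ∷_) (allVecs m k)) (allFin m)

p : ℕ → Digraph → ℕ
p k D = length (filter (isPath? D) (allVecs (length (arcs D)) k))

-- Polynomials in x with integer coefficients, as coefficient sequences
-- (only finitely many nonzero in our uses); equality is pointwise (_≗_).

Poly : Set
Poly = ℕ → ℤ

_⊕_ : Poly → Poly → Poly
(f ⊕ g) k = f k + g k

_⊖_ : Poly → Poly → Poly
(f ⊖ g) k = f k - g k

infixl 6 _⊕_ _⊖_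

x· : Poly → Poly
x· f zero    = + 0
x· f (suc k) = f k

xPoly : Poly
xPoly (suc zero) = + 1
xPoly _          = + 0

-- path polynomial π(D) = Σ_{k=1}^{|V|-1} p_k(D) x^k
-- (p_k(D) = 0 for k = 0 and for k ≥ |V|, so we may take all k)
π : Digraph → Poly
π D zero    = + 0
π D (suc k) = + p (suc k) D

_-ₑ_ : (D : Digraph) → Arc D → Digraph
D -ₑ e = digraph (nV D) (removeAt (arcs D) e)

delV : ∀ {m} → Fin (suc m) → List (Fin (suc m) × Fin (suc m)) → List (Fin m × Fin m)
delV {m} w = mapMaybe f
  where
  f : Fin (suc m) × Fin (suc m) → Maybe (Fin m × Fin m)
  f (a , b) with w ≟ a | w ≟ b
  ... | no w≢a | no w≢b = just (punchOut w≢a , punchOut w≢b)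
  ... | _      | _      = nothing

delVertex : (D : Digraph) → Fin (nV D) → Digraph
delVertex (digraph zero as) ()
delVertex (digraph (suc m) as) w = digraph m (delV w as)

-- identify vertex v with vertex u (u ≢ v): v is removed and u's image is
-- the new merged vertex
merge : ∀ {m} {u v : Fin (suc m)} → u ≢ v → Fin (suc m) → Fin m
merge {v = v} u≢v w with w ≟ v
... | yes _   = punchOut {i = v} (λ eq → u≢v (sym eq))
... | no w≢v  = punchOut {i = v} (λ eq → w≢v (sym eq))

contractArcs : ∀ {m} {u v : Fin (suc m)} → u ≢ v →
               List (Fin (suc m) × Fin (suc m)) → List (Fin m × Fin m)
contractArcs {m} {u} {v} u≢v = mapMaybe f
  where
  f : Fin (suc m) × Fin (suc m) → Maybe (Fin m × Fin m)
  f (a , b) with a ≟ u | b ≟ v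
  ... | no _ | no _ = just (merge u≢v a , merge u≢v b)
  ... | _    | _    = nothing

contractNL : (D : Digraph) (u v : Fin (nV D)) → u ≢ v → Digraph
contractNL (digraph zero as) ()
contractNL (digraph (suc m) as) u v u≢v = digraph m (contractArcs u≢v as)

_/ₑ_ : (D : Digraph) → Arc D → Digraph
D /ₑ e with tl D e ≟ hd D e
... | yes _   = delVertex D (tl D e)
... | no u≢v  = contractNL D (tl D e) (hd D e) u≢v

del2 : (D : Digraph) (u v : Fin (nV D)) → u ≢ v → Digraph
del2 (digraph zero as) ()
del2 (digraph (suc m) as) u v u≢v =
  delVertex (digraph m (delV u as)) (punchOut {i = u} {j = v} u≢v)

_†ₑ_ : (D : Digraph) → Arc D → Digraph
D †ₑ e with tl D e ≟ hd D e
... | yes _   = delVertex D (tl D e)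
... | no u≢v  = del2 D (tl D e) (hd D e) u≢v

module Submission where

-- Split the k-paths of D into those avoiding e, which are the k-paths of D -ₑ e, and those
-- through e.  A path never uses a loop, so for a loop e the second class is empty.  For
-- e = (u, v) with u ≠ v, e itself is the only 1-path through e.  For k ≥ 1, removing e from a
-- (k+1)-path through e and merging u with v gives a k-path of D /ₑ e through the merged vertex
-- w, and this is a bijection: such a path enters u and leaves v, and D /ₑ e lost exactly the
-- arcs out of u and into v.  Finally the k-paths of D /ₑ e avoiding w are the k-paths of D
-- avoiding u and v, i.e. those of D †ₑ e.  Hence p_{k+1}(D) = p_{k+1}(D -ₑ e) + p_k(D /ₑ e)
-- − p_k(D †ₑ e).

open import Defs
open import Data.Nat using (ℕ; zero; suc; _+_; _≤_; z≤n; s≤s)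
open import Data.Nat.Properties using (≤-antisym; +-suc; +-identityʳ)
open import Data.Integer using (+_)
import Data.Integer as ℤ
open import Data.Integer.Properties using (pos-+)
open import Data.Integer.Solver using (module +-*-Solver)
open import Data.List using (List; []; _∷_; length; lookup; filter; map; _++_; concatMap; removeAt; mapMaybe)
import Data.List as List
open import Data.List.Properties using (length-++; filter-≐; filter-none)
open import Data.List.Membership.Propositional using (_∈_; _∉_)
open import Data.List.Membership.Propositional.Properties
  using (∈-∃++; ∈-filter⁺; ∈-filter⁻; ∈-map⁺; ∈-map⁻; ∈-++⁻; ∈-concatMap⁺; ∈-allFin)
open import Data.List.Relation.Unary.Any using (here; there)
import Data.List.Relation.Unary.Any as Any
import Data.List.Relation.Unary.All as All
open import Data.List.Relation.Unary.AllPairs using ([]; _∷_)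
open import Data.List.Relation.Unary.Unique.Propositional using (Unique)
import Data.List.Relation.Unary.Unique.Propositional.Properties as Unique
open import Data.Vec using (Vec; []; _∷_; toList)
import Data.Vec as Vec
open import Data.Vec.Properties using (∷-injectiveˡ; ∷-injectiveʳ; toList-map)
open import Data.Vec.Relation.Unary.All as AllV using ([]; _∷_; all?)
import Data.Vec.Relation.Unary.All.Properties as AllVₚ
open import Data.Maybe using (Maybe; just; nothing) renaming (map to mapᴹ)
open import Data.Maybe.Properties using (just-injective)
open import Data.Fin using (Fin; zero; suc; punchIn; punchOut; _≟_)
open import Data.Fin.Properties
  using (¬Fin0; punchIn-punchOut; punchOut-punchIn; punchOut-cong; punchInᵢ≢i; punchIn-injective)
open import Data.Product using (_×_; _,_; proj₁; proj₂; ∃-syntax)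
import Data.Product as Product
open import Data.Sum using (_⊎_; inj₁; inj₂; [_,_]′)
import Data.Sum as Sum
open import Data.Unit using (tt)
open import Data.Empty using (⊥-elim)
open import Function using (case_of_)
open import Level using (0ℓ)
open import Relation.Nullary using (¬_; Dec; yes; no)
open import Relation.Nullary.Decidable using (_×-dec_; ¬?)
open import Relation.Unary using (Pred; Decidable; _≐_; U)
open import Relation.Unary.Properties using (_∩?_; ∁?; U?)
open import Relation.Binary.PropositionalEquality
open +-*-Solver

private variable k l : ℕ

-- Counting by bijections

module _ {A : Set} {P Q : Pred A 0ℓ} (P? : Decidable P) (Q? : Decidable Q) where

  length-filter-∩∁ : ∀ xs →
    length (filter P? xs) ≡ length (filter (P? ∩? Q?) xs) + length (filter (P? ∩? ∁? Q?) xs)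
  length-filter-∩∁ [] = refl
  length-filter-∩∁ (x ∷ xs) with P? x | Q? x
  ... | yes _ | yes _ = cong suc (length-filter-∩∁ xs)
  ... | yes _ | no _  = trans (cong suc (length-filter-∩∁ xs)) (sym (+-suc _ _))
  ... | no _  | _     = length-filter-∩∁ xs

  length-filter-≐ : P ≐ Q → ∀ xs → length (filter P? xs) ≡ length (filter Q? xs)
  length-filter-≐ P≐Q xs = cong length (filter-≐ P? Q? P≐Q xs)

∈-++-skip : ∀ {A : Set} {x y : A} ys zs → x ∈ ys ++ y ∷ zs → x ≢ y → x ∈ ys ++ zs
∈-++-skip []       zs (here x≡y)  x≢y = ⊥-elim (x≢y x≡y)
∈-++-skip []       zs (there x∈)  x≢y = x∈
∈-++-skip (y ∷ ys) zs (here x≡y)  x≢y = here x≡y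
∈-++-skip (y ∷ ys) zs (there x∈)  x≢y = there (∈-++-skip ys zs x∈ x≢y)

length-≤-injection : ∀ {A B : Set} {xs : List A} {ys : List B} → Unique xs →
  (f : ∀ {x} → x ∈ xs → B) → (∀ {x} (x∈ : x ∈ xs) → f x∈ ∈ ys) →
  (∀ {x x′} (x∈ : x ∈ xs) (x′∈ : x′ ∈ xs) → f x∈ ≡ f x′∈ → x ≡ x′) →
  length xs ≤ length ys
length-≤-injection {xs = []} _ _ _ _ = z≤n
length-≤-injection {B = B} {x ∷ xs} {ys} (x∉ ∷ xs-unique) f f∈ f-inj
  with ys₁ , ys₂ , refl ← ∈-∃++ (f∈ (here refl)) =
  subst (suc (length xs) ≤_) (sym length-ys) (s≤s
    (length-≤-injection xs-unique f∘there f∈′ (λ x∈ x′∈ → f-inj (there x∈) (there x′∈))))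
  where
  f∘there : ∀ {z} → z ∈ xs → B
  f∘there z∈ = f (there z∈)
  length-ys : length (ys₁ ++ f (here refl) ∷ ys₂) ≡ suc (length (ys₁ ++ ys₂))
  length-ys = trans (length-++ ys₁) (trans (+-suc _ _) (cong suc (sym (length-++ ys₁))))
  f∈′ : ∀ {z} (z∈ : z ∈ xs) → f (there z∈) ∈ ys₁ ++ ys₂
  f∈′ z∈ = ∈-++-skip ys₁ ys₂ (f∈ (there z∈))
    (λ eq → All.lookup x∉ z∈ (f-inj (here refl) (there z∈) (sym eq)))

length-filter-bijection : ∀ {A B : Set} {P : Pred A 0ℓ} {Q : Pred B 0ℓ} (P? : Decidable P) (Q? : Decidable Q) →
  {xs : List A} {ys : List B} → Unique xs → Unique ys → (∀ a → a ∈ xs) → (∀ b → b ∈ ys) →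
  (f : A → B) → (∀ {a} → P a → Q (f a)) →
  (∀ {a a′} → P a → P a′ → f a ≡ f a′ → a ≡ a′) →
  (∀ {b} → Q b → ∃[ a ] P a × f a ≡ b) →
  length (filter P? xs) ≡ length (filter Q? ys)
length-filter-bijection {A} {P = P} {Q} P? Q? {xs} {ys} xs-unique ys-unique xs-complete ys-complete
  f f-Q f-injective f-surjective = ≤-antisym forward backward
  where
  P-of : ∀ {a} → a ∈ filter P? xs → P a
  P-of a∈ = proj₂ (∈-filter⁻ P? {xs = xs} a∈)
  Q-of : ∀ {b} → b ∈ filter Q? ys → Q b
  Q-of b∈ = proj₂ (∈-filter⁻ Q? {xs = ys} b∈)
  forward : length (filter P? xs) ≤ length (filter Q? ys)
  forward = length-≤-injection (Unique.filter⁺ P? xs-unique) (λ {a} _ → f a)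
    (λ a∈ → ∈-filter⁺ Q? (ys-complete _) (f-Q (P-of a∈)))
    (λ a∈ a′∈ → f-injective (P-of a∈) (P-of a′∈))
  preimage : ∀ {b} → b ∈ filter Q? ys → A
  preimage b∈ = proj₁ (f-surjective (Q-of b∈))
  P-preimage : ∀ {b} (b∈ : b ∈ filter Q? ys) → P (preimage b∈)
  P-preimage b∈ = proj₁ (proj₂ (f-surjective (Q-of b∈)))
  f-preimage : ∀ {b} (b∈ : b ∈ filter Q? ys) → f (preimage b∈) ≡ b
  f-preimage b∈ = proj₂ (proj₂ (f-surjective (Q-of b∈)))
  backward : length (filter Q? ys) ≤ length (filter P? xs)
  backward = length-≤-injection (Unique.filter⁺ Q? ys-unique) preimage
    (λ b∈ → ∈-filter⁺ P? (xs-complete _) (P-preimage b∈))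
    (λ b∈ b′∈ eq → trans (sym (f-preimage b∈)) (trans (cong f eq) (f-preimage b′∈)))

∈-allVecs : ∀ {m k} (v : Vec (Fin m) k) → v ∈ allVecs m k
∈-allVecs []            = here refl
∈-allVecs {m} {suc k} (a ∷ v) = ∈-concatMap⁺ (λ b → map (b ∷_) (allVecs m k))
  (Any.map (λ { refl → ∈-map⁺ (a ∷_) (∈-allVecs v) }) (∈-allFin a))

module _ {m k} (L : List (Vec (Fin m) k)) where

  private
    prefixWith : List (Fin m) → List (Vec (Fin m) (suc k))
    prefixWith = concatMap (λ b → map (b ∷_) L)

    head∈ : ∀ {v} bs → v ∈ prefixWith bs → Vec.head v ∈ bs
    head∈ (b ∷ bs) v∈ with ∈-++⁻ (map (b ∷_) L) v∈
    ... | inj₂ v∈′ = there (head∈ bs v∈′)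
    ... | inj₁ v∈′ with _ , _ , refl ← ∈-map⁻ (b ∷_) v∈′ = here refl

  prefixWith-unique : ∀ {bs} → Unique bs → Unique L → Unique (prefixWith bs)
  prefixWith-unique {[]}     _               _        = []
  prefixWith-unique {b ∷ bs} (b∉ ∷ bs-unique) L-unique =
    Unique.++⁺ (Unique.map⁺ ∷-injectiveʳ L-unique) (prefixWith-unique bs-unique L-unique) disjoint
    where
    disjoint : ∀ {v} → ¬ (v ∈ map (b ∷_) L × v ∈ prefixWith bs)
    disjoint (v∈ , v∈′) with _ , _ , refl ← ∈-map⁻ (b ∷_) v∈ = All.lookup b∉ (head∈ bs v∈′) refl

allVecs-unique : ∀ m k → Unique (allVecs m k)
allVecs-unique m zero    = All.[] ∷ []
allVecs-unique m (suc k) = prefixWith-unique (allVecs m k) (Unique.allFin⁺ m) (allVecs-unique m k)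

-- Paths

heads : (D : Digraph) → Vec (Arc D) k → List (Fin (nV D))
heads D es = toList (Vec.map (hd D) es)

vertices : (D : Digraph) → Vec (Arc D) (suc k) → List (Fin (nV D))
vertices D (e ∷ es) = tl D e ∷ heads D (e ∷ es)

#seqs : (D : Digraph) (k : ℕ) {Φ : Pred (Vec (Arc D) k) 0ℓ} → Decidable Φ → ℕ
#seqs D k Φ? = length (filter Φ? (allVecs (length (arcs D)) k))

#seqs-bijection : ∀ D E {Φ : Pred (Vec (Arc D) k) 0ℓ} {Ψ : Pred (Vec (Arc E) l) 0ℓ}
  (Φ? : Decidable Φ) (Ψ? : Decidable Ψ) (f : Vec (Arc D) k → Vec (Arc E) l) →
  (∀ {es} → Φ es → Ψ (f es)) →
  (∀ {es es′} → Φ es → Φ es′ → f es ≡ f es′ → es ≡ es′) →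
  (∀ {fs} → Ψ fs → ∃[ es ] Φ es × f es ≡ fs) →
  #seqs D k Φ? ≡ #seqs E l Ψ?
#seqs-bijection {k} {l} D E Φ? Ψ? = length-filter-bijection Φ? Ψ?
  (allVecs-unique _ k) (allVecs-unique _ l) ∈-allVecs ∈-allVecs

module _ (D : Digraph) {Q : Pred (Arc D) 0ℓ} (Q? : Decidable Q) where

  #pathsAll : ℕ → ℕ
  #pathsAll k = #seqs D k (isPath? D ∩? all? Q?)

  #pathsNotAll : ℕ → ℕ
  #pathsNotAll k = #seqs D k (isPath? D ∩? ∁? (all? Q?))

  p≡#pathsAll+#pathsNotAll : ∀ k → p k D ≡ #pathsAll k + #pathsNotAll k
  p≡#pathsAll+#pathsNotAll k = length-filter-∩∁ (isPath? D) (all? Q?) (allVecs _ k)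

#pathsAll-cong : ∀ D {Q Q′ : Pred (Arc D) 0ℓ} (Q? : Decidable Q) (Q′? : Decidable Q′) → Q ≐ Q′ →
  ∀ k → #pathsAll D Q? k ≡ #pathsAll D Q′? k
#pathsAll-cong D Q? Q′? (Q⊆Q′ , Q′⊆Q) k = length-filter-≐ (isPath? D ∩? all? Q?) (isPath? D ∩? all? Q′?)
  ((λ (es-path , Q-all) → es-path , AllV.map Q⊆Q′ Q-all) ,
   (λ (es-path , Q′-all) → es-path , AllV.map Q′⊆Q Q′-all))
  (allVecs _ k)

p≡#pathsAll-U : ∀ D k → p k D ≡ #pathsAll D U? k
p≡#pathsAll-U D k = length-filter-≐ (isPath? D) (isPath? D ∩? all? U?)
  ((λ es-path → es-path , AllV.universal _ _) , proj₁) (allVecs _ k)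

module _ (D : Digraph) where

  mkPath : ∀ {es : Vec (Arc D) (suc k)} → Linked D es → Unique (vertices D es) → IsPath D es
  mkPath {es = _ ∷ _} linked unique = linked , unique

  path-linked : ∀ {es : Vec (Arc D) (suc k)} → IsPath D es → Linked D es
  path-linked {es = _ ∷ _} = proj₁

  path-unique : ∀ {es : Vec (Arc D) (suc k)} → IsPath D es → Unique (vertices D es)
  path-unique {es = _ ∷ _} = proj₂

  path-∷⁻ : ∀ {a b} {bs : Vec (Arc D) k} → IsPath D (a ∷ b ∷ bs) → IsPath D (b ∷ bs)
  path-∷⁻ {b = b} {bs} ((a→b , linked) , _ ∷ unique) =
    linked , subst (λ x → Unique (x ∷ heads D (b ∷ bs))) a→b unique

  hd∈heads : ∀ {x} {es : Vec (Arc D) k} → x ∈ toList es → hd D x ∈ heads D es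
  hd∈heads {es = _ ∷ _} (here refl) = here refl
  hd∈heads {es = _ ∷ _} (there x∈)  = there (hd∈heads x∈)

  tl∈heads : ∀ {a y} {es : Vec (Arc D) k} → Linked D (a ∷ es) → y ∈ toList es → tl D y ∈ heads D (a ∷ es)
  tl∈heads {es = _ ∷ _} (a→b , _)      (here refl) = here (sym a→b)
  tl∈heads {es = _ ∷ _} (_ , linked) (there y∈)  = there (tl∈heads linked y∈)

  path-hd-injective : ∀ {es : Vec (Arc D) k} → IsPath D es → ∀ {x y} → x ∈ toList es → y ∈ toList es →
    hd D x ≡ hd D y → x ≡ y
  path-hd-injective {es = a ∷ es} (_ , _ ∷ unique) = go (a ∷ es) (subst Unique (toList-map (hd D) (a ∷ es)) unique)
    where
    go : ∀ {k} (xs : Vec (Arc D) k) → Unique (map (hd D) (toList xs)) →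
      ∀ {x y} → x ∈ toList xs → y ∈ toList xs → hd D x ≡ hd D y → x ≡ y
    go (_ ∷ _)  _             (here refl) (here refl) _  = refl
    go (_ ∷ xs) (x∉ ∷ _)      (here refl) (there y∈)  eq = ⊥-elim (All.lookup x∉ (∈-map⁺ (hd D) y∈) eq)
    go (_ ∷ xs) (y∉ ∷ _)      (there x∈)  (here refl) eq = ⊥-elim (All.lookup y∉ (∈-map⁺ (hd D) x∈) (sym eq))
    go (_ ∷ xs) (_ ∷ unique)  (there x∈)  (there y∈)  eq = go xs unique x∈ y∈ eq

  path-start-∉-heads : ∀ {a} {es : Vec (Arc D) k} → IsPath D (a ∷ es) → tl D a ∉ heads D (a ∷ es)
  path-start-∉-heads (_ , tl∉ ∷ _) tl∈ = All.lookup tl∉ tl∈ refl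

  path-first-∉-rest : ∀ {a x} {es : Vec (Arc D) k} → IsPath D (a ∷ es) → x ∈ toList es → x ≢ a
  path-first-∉-rest (_ , _ ∷ hd∉ ∷ _) x∈ refl = All.lookup hd∉ (hd∈heads x∈) refl

  path-tl-injective : ∀ {es : Vec (Arc D) k} → IsPath D es → ∀ {x y} → x ∈ toList es → y ∈ toList es →
    tl D x ≡ tl D y → x ≡ y
  path-tl-injective {es = a ∷ []}     _    (here refl) (here refl) _  = refl
  path-tl-injective {es = a ∷ b ∷ bs} path (here refl) (here refl) _  = refl
  path-tl-injective {es = a ∷ b ∷ bs} path (here refl) (there y∈)  eq =
    ⊥-elim (path-start-∉-heads path (subst (_∈ heads D (a ∷ b ∷ bs)) (sym eq) (tl∈heads (proj₁ path) y∈)))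
  path-tl-injective {es = a ∷ b ∷ bs} path (there x∈)  (here refl) eq =
    ⊥-elim (path-start-∉-heads path (subst (_∈ heads D (a ∷ b ∷ bs)) eq (tl∈heads (proj₁ path) x∈)))
  path-tl-injective {es = a ∷ b ∷ bs} path (there x∈)  (there y∈)  eq =
    path-tl-injective (path-∷⁻ path) x∈ y∈ eq

  path-loop-free : ∀ {es : Vec (Arc D) k} → IsPath D es → ∀ {x} → x ∈ toList es → tl D x ≢ hd D x
  path-loop-free {es = _ ∷ _}     (_ , tl∉ ∷ _) (here refl) = All.lookup tl∉ (here refl)
  path-loop-free {es = _ ∷ _ ∷ _} path          (there x∈)  = path-loop-free (path-∷⁻ path) x∈

  Avoids : Fin (nV D) → Pred (Arc D) 0ℓ
  Avoids x a = tl D a ≢ x × hd D a ≢ x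

  avoids? : ∀ x → Decidable (Avoids x)
  avoids? x a = ¬? (tl D a ≟ x) ×-dec ¬? (hd D a ≟ x)

  ∈vertices⇒¬avoids : ∀ {x} {es : Vec (Arc D) (suc k)} → x ∈ vertices D es → ¬ AllV.All (Avoids x) es
  ∈vertices⇒¬avoids {es = _ ∷ _} (here x≡tl) ((tl≢x , _) ∷ _) = tl≢x (sym x≡tl)
  ∈vertices⇒¬avoids {es = _ ∷ _} (there x∈) avoids = ∈heads⇒¬avoids x∈ avoids
    where
    ∈heads⇒¬avoids : ∀ {k x} {es : Vec (Arc D) k} → x ∈ heads D es → ¬ AllV.All (Avoids x) es
    ∈heads⇒¬avoids {es = _ ∷ _} (here x≡hd) ((_ , hd≢x) ∷ _) = hd≢x (sym x≡hd)
    ∈heads⇒¬avoids {es = _ ∷ _} (there x∈) (_ ∷ avoids)     = ∈heads⇒¬avoids x∈ avoids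

  ¬avoids⇒∈vertices : ∀ {x} {es : Vec (Arc D) (suc k)} → Linked D es → ¬ AllV.All (Avoids x) es →
    x ∈ vertices D es
  ¬avoids⇒∈vertices {x = x} {es = a ∷ es} linked ¬avoids with tl D a ≟ x | hd D a ≟ x
  ... | yes tl≡x | _        = here (sym tl≡x)
  ... | no _     | yes hd≡x = there (here (sym hd≡x))
  ¬avoids⇒∈vertices {es = a ∷ []}     _                 ¬avoids | no tl≢x | no hd≢x =
    ⊥-elim (¬avoids ((tl≢x , hd≢x) ∷ []))
  ¬avoids⇒∈vertices {es = a ∷ b ∷ bs} (a→b , linked) ¬avoids | no tl≢x | no hd≢x
    with ¬avoids⇒∈vertices linked (λ avoids → ¬avoids ((tl≢x , hd≢x) ∷ avoids))
  ... | here x≡tl = there (here (trans x≡tl (sym a→b)))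
  ... | there x∈  = there (there x∈)

-- Arc embeddings

map-injective : ∀ {A B : Set} {f : A → B} → (∀ {x y} → f x ≡ f y → x ≡ y) →
  ∀ {xs ys : Vec A k} → Vec.map f xs ≡ Vec.map f ys → xs ≡ ys
map-injective f-injective {[]}     {[]}     _  = refl
map-injective f-injective {x ∷ xs} {y ∷ ys} eq =
  cong₂ _∷_ (f-injective (cong Vec.head eq)) (map-injective f-injective (cong Vec.tail eq))

-- arc⁻¹ is a partial inverse of arc; only the Kept arcs are required to keep their endpoints.
record ArcEmbedding (D′ D : Digraph) : Set₁ where
  field
    arc              : Arc D′ → Arc D
    arc⁻¹            : Arc D → Maybe (Arc D′)
    arc⁻¹-arc        : ∀ c → arc⁻¹ (arc c) ≡ just c
    arc-arc⁻¹        : ∀ {a c} → arc⁻¹ a ≡ just c → arc c ≡ a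
    vertex           : Fin (nV D′) → Fin (nV D)
    vertex-injective : ∀ {x y} → vertex x ≡ vertex y → x ≡ y
    Kept             : Pred (Arc D′) 0ℓ
    kept?            : Decidable Kept
    tl-arc           : ∀ {c} → Kept c → tl D (arc c) ≡ vertex (tl D′ c)
    hd-arc           : ∀ {c} → Kept c → hd D (arc c) ≡ vertex (hd D′ c)

module _ {D′ D : Digraph} (E : ArcEmbedding D′ D) where
  open ArcEmbedding E

  KeptImage : Pred (Arc D) 0ℓ
  KeptImage a = ∃[ c ] arc⁻¹ a ≡ just c × Kept c

  keptImage? : Decidable KeptImage
  keptImage? a with arc⁻¹ a
  ... | nothing = no λ ()
  ... | just c with kept? c
  ...   | yes kept = yes (c , refl , kept)
  ...   | no ¬kept = no λ { (_ , refl , kept) → ¬kept kept }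

  private
    arc-injective : ∀ {c c′} → arc c ≡ arc c′ → c ≡ c′
    arc-injective {c} {c′} eq = just-injective (trans (sym (arc⁻¹-arc c)) (trans (cong arc⁻¹ eq) (arc⁻¹-arc c′)))

    linked⁺ : ∀ {cs : Vec (Arc D′) k} → AllV.All Kept cs → Linked D′ cs → Linked D (Vec.map arc cs)
    linked⁺ {cs = []}         _                   _               = tt
    linked⁺ {cs = _ ∷ []}     _                   _               = tt
    linked⁺ {cs = _ ∷ _ ∷ _}  (kc ∷ kd ∷ kept) (c→d , linked) =
      trans (hd-arc kc) (trans (cong vertex c→d) (sym (tl-arc kd))) , linked⁺ (kd ∷ kept) linked

    linked⁻ : ∀ {cs : Vec (Arc D′) k} → AllV.All Kept cs → Linked D (Vec.map arc cs) → Linked D′ cs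
    linked⁻ {cs = []}         _                   _               = tt
    linked⁻ {cs = _ ∷ []}     _                   _               = tt
    linked⁻ {cs = _ ∷ _ ∷ _}  (kc ∷ kd ∷ kept) (c→d , linked) =
      vertex-injective (trans (sym (hd-arc kc)) (trans c→d (tl-arc kd))) , linked⁻ (kd ∷ kept) linked

    heads-map : ∀ {cs : Vec (Arc D′) k} → AllV.All Kept cs →
      heads D (Vec.map arc cs) ≡ List.map vertex (heads D′ cs)
    heads-map []            = refl
    heads-map (kc ∷ kept) = cong₂ _∷_ (hd-arc kc) (heads-map kept)

    vertices-map : ∀ {cs : Vec (Arc D′) (suc k)} → AllV.All Kept cs →
      vertices D (Vec.map arc cs) ≡ List.map vertex (vertices D′ cs)
    vertices-map (kc ∷ kept) = cong₂ _∷_ (tl-arc kc) (heads-map (kc ∷ kept))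

    path⁺ : ∀ {cs : Vec (Arc D′) k} → AllV.All Kept cs → IsPath D′ cs → IsPath D (Vec.map arc cs)
    path⁺ {cs = _ ∷ _} kept (linked , unique) =
      linked⁺ kept linked , subst Unique (sym (vertices-map kept)) (Unique.map⁺ vertex-injective unique)

    path⁻ : ∀ {cs : Vec (Arc D′) k} → AllV.All Kept cs → IsPath D (Vec.map arc cs) → IsPath D′ cs
    path⁻ {cs = _ ∷ _} kept (linked , unique) =
      linked⁻ kept linked , Unique.map⁻ (subst Unique (vertices-map kept) unique)

    keptImage⁺ : ∀ {cs : Vec (Arc D′) k} → AllV.All Kept cs → AllV.All KeptImage (Vec.map arc cs)
    keptImage⁺ {cs = []}     []            = []
    keptImage⁺ {cs = c ∷ _}  (kc ∷ kept) = (c , arc⁻¹-arc c , kc) ∷ keptImage⁺ kept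

    preimage : ∀ {es : Vec (Arc D) k} → AllV.All KeptImage es → ∃[ cs ] AllV.All Kept cs × Vec.map arc cs ≡ es
    preimage []                              = [] , [] , refl
    preimage ((c , arc⁻¹a≡c , kc) ∷ images) with cs , kept , refl ← preimage images =
      c ∷ cs , kc ∷ kept , cong (_∷ _) (arc-arc⁻¹ arc⁻¹a≡c)

  #pathsAll-embedding : ∀ k → #pathsAll D′ kept? k ≡ #pathsAll D keptImage? k
  #pathsAll-embedding k = #seqs-bijection {k} {k} D′ D
    (isPath? D′ ∩? all? kept?) (isPath? D ∩? all? keptImage?) (Vec.map arc)
    (λ (path , kept) → path⁺ kept path , keptImage⁺ kept)
    (λ _ _ → map-injective arc-injective)
    λ (path , images) → let cs , kept , map-cs≡ = preimage images in
      cs , (path⁻ kept (subst (IsPath D) (sym map-cs≡) path) , kept) , map-cs≡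

module _ {X : Set} where

  removeAt-index : (xs : List X) (i : Fin (length xs)) → Fin (length (removeAt xs i)) → Fin (length xs)
  removeAt-index (x ∷ xs) zero    j       = suc j
  removeAt-index (x ∷ xs) (suc i) zero    = zero
  removeAt-index (x ∷ xs) (suc i) (suc j) = suc (removeAt-index xs i j)

  removeAt-index⁻¹ : (xs : List X) (i : Fin (length xs)) → Fin (length xs) → Maybe (Fin (length (removeAt xs i)))
  removeAt-index⁻¹ (x ∷ xs) zero    zero    = nothing
  removeAt-index⁻¹ (x ∷ xs) zero    (suc a) = just a
  removeAt-index⁻¹ (x ∷ xs) (suc i) zero    = just zero
  removeAt-index⁻¹ (x ∷ xs) (suc i) (suc a) = mapᴹ suc (removeAt-index⁻¹ xs i a)

  lookup-removeAt-index : (xs : List X) (i : Fin (length xs)) (j : Fin (length (removeAt xs i))) →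
    lookup xs (removeAt-index xs i j) ≡ lookup (removeAt xs i) j
  lookup-removeAt-index (x ∷ xs) zero    j       = refl
  lookup-removeAt-index (x ∷ xs) (suc i) zero    = refl
  lookup-removeAt-index (x ∷ xs) (suc i) (suc j) = lookup-removeAt-index xs i j

  removeAt-index⁻¹-index : (xs : List X) (i : Fin (length xs)) (j : Fin (length (removeAt xs i))) →
    removeAt-index⁻¹ xs i (removeAt-index xs i j) ≡ just j
  removeAt-index⁻¹-index (x ∷ xs) zero    j       = refl
  removeAt-index⁻¹-index (x ∷ xs) (suc i) zero    = refl
  removeAt-index⁻¹-index (x ∷ xs) (suc i) (suc j) = cong (mapᴹ suc) (removeAt-index⁻¹-index xs i j)

  removeAt-index-index⁻¹ : (xs : List X) (i a : Fin (length xs)) {j : Fin (length (removeAt xs i))} →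
    removeAt-index⁻¹ xs i a ≡ just j → removeAt-index xs i j ≡ a
  removeAt-index-index⁻¹ (x ∷ xs) zero    (suc a) refl = refl
  removeAt-index-index⁻¹ (x ∷ xs) (suc i) zero    refl = refl
  removeAt-index-index⁻¹ (x ∷ xs) (suc i) (suc a) eq with removeAt-index⁻¹ xs i a in eq′
  removeAt-index-index⁻¹ (x ∷ xs) (suc i) (suc a) refl | just j = cong suc (removeAt-index-index⁻¹ xs i a eq′)

  removeAt-index⁻¹-removed : (xs : List X) (i : Fin (length xs)) → removeAt-index⁻¹ xs i i ≡ nothing
  removeAt-index⁻¹-removed (x ∷ xs) zero    = refl
  removeAt-index⁻¹-removed (x ∷ xs) (suc i) = cong (mapᴹ suc) (removeAt-index⁻¹-removed xs i)

  removeAt-index⁻¹-kept : (xs : List X) (i a : Fin (length xs)) → a ≢ i →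
    ∃[ j ] removeAt-index⁻¹ xs i a ≡ just j
  removeAt-index⁻¹-kept (x ∷ xs) zero    zero    a≢i = ⊥-elim (a≢i refl)
  removeAt-index⁻¹-kept (x ∷ xs) zero    (suc a) a≢i = a , refl
  removeAt-index⁻¹-kept (x ∷ xs) (suc i) zero    a≢i = zero , refl
  removeAt-index⁻¹-kept (x ∷ xs) (suc i) (suc a) a≢i
    with j , eq ← removeAt-index⁻¹-kept xs i a (λ a≡i → a≢i (cong suc a≡i)) = suc j , cong (mapᴹ suc) eq

module _ {X Y : Set} (h : X → Maybe Y) where

  mapMaybe-index : (xs : List X) → Fin (length (mapMaybe h xs)) → Fin (length xs)
  mapMaybe-index (x ∷ xs) j with h x
  mapMaybe-index (x ∷ xs) zero    | just _  = zero
  mapMaybe-index (x ∷ xs) (suc j) | just _  = suc (mapMaybe-index xs j)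
  mapMaybe-index (x ∷ xs) j       | nothing = suc (mapMaybe-index xs j)

  mapMaybe-index⁻¹ : (xs : List X) → Fin (length xs) → Maybe (Fin (length (mapMaybe h xs)))
  mapMaybe-index⁻¹ (x ∷ xs) a with h x
  mapMaybe-index⁻¹ (x ∷ xs) zero    | just _  = just zero
  mapMaybe-index⁻¹ (x ∷ xs) (suc a) | just _  = mapᴹ suc (mapMaybe-index⁻¹ xs a)
  mapMaybe-index⁻¹ (x ∷ xs) zero    | nothing = nothing
  mapMaybe-index⁻¹ (x ∷ xs) (suc a) | nothing = mapMaybe-index⁻¹ xs a

  lookup-mapMaybe-index : (xs : List X) (j : Fin (length (mapMaybe h xs))) →
    h (lookup xs (mapMaybe-index xs j)) ≡ just (lookup (mapMaybe h xs) j)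
  lookup-mapMaybe-index (x ∷ xs) j with h x in eq
  lookup-mapMaybe-index (x ∷ xs) zero    | just _  = eq
  lookup-mapMaybe-index (x ∷ xs) (suc j) | just _  = lookup-mapMaybe-index xs j
  lookup-mapMaybe-index (x ∷ xs) j       | nothing = lookup-mapMaybe-index xs j

  mapMaybe-index⁻¹-index : (xs : List X) (j : Fin (length (mapMaybe h xs))) →
    mapMaybe-index⁻¹ xs (mapMaybe-index xs j) ≡ just j
  mapMaybe-index⁻¹-index (x ∷ xs) j with h x
  mapMaybe-index⁻¹-index (x ∷ xs) zero    | just _  = refl
  mapMaybe-index⁻¹-index (x ∷ xs) (suc j) | just _  = cong (mapᴹ suc) (mapMaybe-index⁻¹-index xs j)
  mapMaybe-index⁻¹-index (x ∷ xs) j       | nothing = mapMaybe-index⁻¹-index xs j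

  mapMaybe-index-index⁻¹ : (xs : List X) (a : Fin (length xs)) {j : Fin (length (mapMaybe h xs))} →
    mapMaybe-index⁻¹ xs a ≡ just j → mapMaybe-index xs j ≡ a
  mapMaybe-index-index⁻¹ (x ∷ xs) a eq with h x
  mapMaybe-index-index⁻¹ (x ∷ xs) zero    refl | just _ = refl
  mapMaybe-index-index⁻¹ (x ∷ xs) (suc a) eq   | just _ with mapMaybe-index⁻¹ xs a in eq′
  mapMaybe-index-index⁻¹ (x ∷ xs) (suc a) refl | just _ | just j = cong suc (mapMaybe-index-index⁻¹ xs a eq′)
  mapMaybe-index-index⁻¹ (x ∷ xs) (suc a) eq   | nothing = cong suc (mapMaybe-index-index⁻¹ xs a eq)

  mapMaybe-index⁻¹-kept : (xs : List X) (a : Fin (length xs)) {y : Y} → h (lookup xs a) ≡ just y →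
    ∃[ j ] mapMaybe-index⁻¹ xs a ≡ just j
  mapMaybe-index⁻¹-kept (x ∷ xs) a eq with h x in eq′
  mapMaybe-index⁻¹-kept (x ∷ xs) zero    eq | just _ = zero , refl
  mapMaybe-index⁻¹-kept (x ∷ xs) (suc a) eq | just _
    with j , eq″ ← mapMaybe-index⁻¹-kept xs a eq = suc j , cong (mapᴹ suc) eq″
  mapMaybe-index⁻¹-kept (x ∷ xs) zero    eq | nothing with () ← trans (sym eq) eq′
  mapMaybe-index⁻¹-kept (x ∷ xs) (suc a) eq | nothing = mapMaybe-index⁻¹-kept xs a eq

deleteArc-embedding : (D : Digraph) (e : Arc D) → ArcEmbedding (D -ₑ e) D
deleteArc-embedding D e = record
  { arc              = removeAt-index (arcs D) e
  ; arc⁻¹            = removeAt-index⁻¹ (arcs D) e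
  ; arc⁻¹-arc        = removeAt-index⁻¹-index (arcs D) e
  ; arc-arc⁻¹        = removeAt-index-index⁻¹ (arcs D) e _
  ; vertex           = λ x → x
  ; vertex-injective = λ eq → eq
  ; Kept             = U
  ; kept?            = U?
  ; tl-arc           = λ {c} _ → cong proj₁ (lookup-removeAt-index (arcs D) e c)
  ; hd-arc           = λ {c} _ → cong proj₂ (lookup-removeAt-index (arcs D) e c)
  }

module _ {n n′ : ℕ} (as : List (Fin n × Fin n)) (h : Fin n × Fin n → Maybe (Fin n′ × Fin n′))
  (φ : Fin n′ → Fin n) (φ-injective : ∀ {x y} → φ x ≡ φ y → x ≡ y)
  {Kept : Pred (Arc (digraph n′ (mapMaybe h as))) 0ℓ} (kept? : Decidable Kept)
  (lift : ∀ {c a b} → Kept c → h (a , b) ≡ just (lookup (mapMaybe h as) c) →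
          φ (tl (digraph n′ (mapMaybe h as)) c) ≡ a × φ (hd (digraph n′ (mapMaybe h as)) c) ≡ b)
  where

  mapMaybe-embedding : ArcEmbedding (digraph n′ (mapMaybe h as)) (digraph n as)
  mapMaybe-embedding = record
    { arc              = mapMaybe-index h as
    ; arc⁻¹            = mapMaybe-index⁻¹ h as
    ; arc⁻¹-arc        = mapMaybe-index⁻¹-index h as
    ; arc-arc⁻¹        = mapMaybe-index-index⁻¹ h as _
    ; vertex           = φ
    ; vertex-injective = φ-injective
    ; Kept             = Kept
    ; kept?            = kept?
    ; tl-arc           = λ {c} kept → sym (proj₁ (lift kept (lookup-mapMaybe-index h as c)))
    ; hd-arc           = λ {c} kept → sym (proj₂ (lift kept (lookup-mapMaybe-index h as c)))
    }

module _ {m : ℕ} (w : Fin (suc m)) where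

  -- The arc map of delV, which Defs keeps local to a where block.
  avoid : Fin (suc m) × Fin (suc m) → Maybe (Fin m × Fin m)
  avoid (a , b) with w ≟ a | w ≟ b
  ... | no w≢a | no w≢b = just (punchOut w≢a , punchOut w≢b)
  ... | yes _  | _      = nothing
  ... | no _   | yes _  = nothing

  delV-mapMaybe : ∀ as → delV w as ≡ mapMaybe avoid as
  delV-mapMaybe [] = refl
  delV-mapMaybe ((a , b) ∷ as) with w ≟ a | w ≟ b
  ... | no _  | no _  = cong (_ ∷_) (delV-mapMaybe as)
  ... | yes _ | _     = delV-mapMaybe as
  ... | no _  | yes _ = delV-mapMaybe as

  avoid-just⁻ : ∀ {a b a′ b′} → avoid (a , b) ≡ just (a′ , b′) →
    w ≢ a × w ≢ b × punchIn w a′ ≡ a × punchIn w b′ ≡ b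
  avoid-just⁻ {a} {b} eq with w ≟ a | w ≟ b
  avoid-just⁻ refl | no w≢a | no w≢b = w≢a , w≢b , punchIn-punchOut w≢a , punchIn-punchOut w≢b

  avoid-just : ∀ {a b} → w ≢ a → w ≢ b → ∃[ y ] avoid (a , b) ≡ just y
  avoid-just {a} {b} w≢a w≢b with w ≟ a | w ≟ b
  ... | no _     | no _     = _ , refl
  ... | yes w≡a  | _        = ⊥-elim (w≢a w≡a)
  ... | no _     | yes w≡b  = ⊥-elim (w≢b w≡b)

  deleteVertex-embedding : ∀ as {Kept : Pred (Arc (digraph m (mapMaybe avoid as))) 0ℓ} → Decidable Kept →
    ArcEmbedding (digraph m (mapMaybe avoid as)) (digraph (suc m) as)
  deleteVertex-embedding as kept? = mapMaybe-embedding as avoid (punchIn w) (punchIn-injective w _ _) kept?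
    λ _ eq → let _ , _ , tl≡ , hd≡ = avoid-just⁻ eq in tl≡ , hd≡

-- Paths through an arc

#pathsVia : (D : Digraph) → Arc D → ℕ → ℕ
#pathsVia D e = #pathsNotAll D (λ a → ¬? (a ≟ e))

p-deleteArc : ∀ D e k → p k D ≡ p k (D -ₑ e) + #pathsVia D e k
p-deleteArc D e k = begin
  p k D                                                  ≡⟨ p≡#pathsAll+#pathsNotAll D (λ a → ¬? (a ≟ e)) k ⟩
  #pathsAll D (λ a → ¬? (a ≟ e)) k + #pathsVia D e k      ≡⟨ cong (_+ #pathsVia D e k) avoiding-e ⟩
  p k (D -ₑ e) + #pathsVia D e k                          ∎
  where
  open ≡-Reasoning
  E = deleteArc-embedding D e
  keptImage⇔≢e : (_≢ e) ≐ KeptImage E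
  keptImage⇔≢e = (λ {a} a≢e → let j , eq = removeAt-index⁻¹-kept (arcs D) e a a≢e in j , eq , tt)
               , λ { (_ , eq , _) refl → case trans (sym (removeAt-index⁻¹-removed (arcs D) e)) eq of λ () }
  avoiding-e : #pathsAll D (λ a → ¬? (a ≟ e)) k ≡ p k (D -ₑ e)
  avoiding-e = begin
    #pathsAll D (λ a → ¬? (a ≟ e)) k   ≡⟨ #pathsAll-cong D _ (keptImage? E) keptImage⇔≢e k ⟩
    #pathsAll D (keptImage? E) k       ≡⟨ #pathsAll-embedding E k ⟨
    #pathsAll (D -ₑ e) U? k            ≡⟨ p≡#pathsAll-U (D -ₑ e) k ⟨
    p k (D -ₑ e)                       ∎

#pathsVia-loop : ∀ D e → IsLoop D e → ∀ k → #pathsVia D e k ≡ 0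
#pathsVia-loop D e e-loop k = cong length (filter-none (isPath? D ∩? ∁? (all? (λ a → ¬? (a ≟ e)))) {allVecs _ k}
  (All.tabulate λ {es} _ (path , ¬avoids) → ¬avoids (AllVₚ.toList⁻ (All.tabulate (λ {a} a∈ a≡e →
    path-loop-free D path a∈ (subst (λ x → tl D x ≡ hd D x) (sym a≡e) e-loop))))))

#pathsVia-1 : ∀ D e → ¬ IsLoop D e → #pathsVia D e 1 ≡ 1
#pathsVia-1 D e ¬loop = length-filter-bijection (isPath? D ∩? ∁? (all? (λ a → ¬? (a ≟ e)))) U? {ys = tt ∷ []}
  (allVecs-unique _ 1) (All.[] ∷ []) ∈-allVecs (λ _ → here refl) (λ _ → tt) (λ _ → tt)
  (λ (_ , ¬avoid) (_ , ¬avoid′) _ → trans (≡e ¬avoid) (sym (≡e ¬avoid′)))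
  λ _ → e ∷ [] , (path , λ { (e≢e ∷ []) → e≢e refl }) , refl
  where
  ≡e : ∀ {es : Vec (Arc D) 1} → ¬ AllV.All (_≢ e) es → es ≡ e ∷ []
  ≡e {a ∷ []} ¬avoid with a ≟ e
  ... | yes refl = refl
  ... | no a≢e   = ⊥-elim (¬avoid (a≢e ∷ []))
  path : IsPath D (e ∷ [])
  path = tt , (¬loop All.∷ All.[]) ∷ All.[] ∷ []

-- Contraction

module Merge {m : ℕ} {u v : Fin (suc m)} (u≢v : u ≢ v) where

  v≢u : v ≢ u
  v≢u = ≢-sym u≢v

  w : Fin m
  w = merge u≢v u

  w≡punchOut : w ≡ punchOut v≢u
  w≡punchOut with u ≟ v
  ... | yes u≡v = ⊥-elim (u≢v u≡v)
  ... | no _    = punchOut-cong v refl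

  merge-v : merge u≢v v ≡ w
  merge-v with v ≟ v
  ... | yes _   = sym w≡punchOut
  ... | no v≢v  = ⊥-elim (v≢v refl)

  punchIn-w : punchIn v w ≡ u
  punchIn-w = trans (cong (punchIn v) w≡punchOut) (punchIn-punchOut v≢u)

  merge-punchIn : ∀ z → merge u≢v (punchIn v z) ≡ z
  merge-punchIn z with punchIn v z ≟ v
  ... | yes eq = ⊥-elim (punchInᵢ≢i v z eq)
  ... | no _   = trans (punchOut-cong v refl) (punchOut-punchIn v)

  punchIn-merge : ∀ {x} → x ≢ v → punchIn v (merge u≢v x) ≡ x
  punchIn-merge {x} x≢v with x ≟ v
  ... | yes x≡v = ⊥-elim (x≢v x≡v)
  ... | no _    = punchIn-punchOut _

  merge≡w⁻ : ∀ {x} → merge u≢v x ≡ w → x ≡ u ⊎ x ≡ v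
  merge≡w⁻ {x} eq with x ≟ v
  ... | yes x≡v = inj₂ x≡v
  ... | no _    = inj₁ (trans (sym (punchIn-punchOut _)) (trans (cong (punchIn v) eq) punchIn-w))

  unmerge : Fin (suc m) → Fin m → Fin (suc m)
  unmerge y x with x ≟ w
  ... | yes _ = y
  ... | no _  = punchIn v x

  unmerge-w : ∀ {y x} → x ≡ w → unmerge y x ≡ y
  unmerge-w {y} {x} x≡w with x ≟ w
  ... | yes _   = refl
  ... | no x≢w  = ⊥-elim (x≢w x≡w)

  unmerge-≢w : ∀ {y x} → x ≢ w → unmerge y x ≡ punchIn v x
  unmerge-≢w {y} {x} x≢w with x ≟ w
  ... | yes x≡w = ⊥-elim (x≢w x≡w)
  ... | no _    = refl

  merge-unmerge-u : ∀ x → merge u≢v (unmerge u x) ≡ x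
  merge-unmerge-u x with x ≟ w
  ... | yes x≡w = sym x≡w
  ... | no _    = merge-punchIn x

  unmerge-injective : ∀ {x y} → unmerge u x ≡ unmerge u y → x ≡ y
  unmerge-injective {x} {y} eq = trans (sym (merge-unmerge-u x)) (trans (cong (merge u≢v) eq) (merge-unmerge-u y))

  unmerge-merge-tl : ∀ {a} → a ≢ u → unmerge v (merge u≢v a) ≡ a
  unmerge-merge-tl {a} a≢u with merge u≢v a ≟ w
  ... | yes a↦w = [ (λ a≡u → ⊥-elim (a≢u a≡u)) , sym ]′ (merge≡w⁻ a↦w)
  ... | no a↦̸w  = punchIn-merge (λ a≡v → a↦̸w (trans (cong (merge u≢v) a≡v) merge-v))

  unmerge-merge-hd : ∀ {b} → b ≢ v → unmerge u (merge u≢v b) ≡ b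
  unmerge-merge-hd {b} b≢v with merge u≢v b ≟ w
  ... | yes b↦w = [ sym , (λ b≡v → ⊥-elim (b≢v b≡v)) ]′ (merge≡w⁻ b↦w)
  ... | no _    = punchIn-merge b≢v

  -- The arc map applied by contractArcs, with the two tests as arguments so that
  -- the merge in its result is not caught by with-abstraction over b ≟ v.
  contractArc′ : ∀ a b → Dec (a ≡ u) → Dec (b ≡ v) → Maybe (Fin m × Fin m)
  contractArc′ a b (no _)  (no _)  = just (merge u≢v a , merge u≢v b)
  contractArc′ a b (yes _) _       = nothing
  contractArc′ a b (no _)  (yes _) = nothing

  contractArc : Fin (suc m) × Fin (suc m) → Maybe (Fin m × Fin m)
  contractArc (a , b) = contractArc′ a b (a ≟ u) (b ≟ v)

  contractArcs-mapMaybe : ∀ as → contractArcs u≢v as ≡ mapMaybe contractArc as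
  contractArcs-mapMaybe [] = refl
  contractArcs-mapMaybe ((a , b) ∷ as) with a ≟ u | b ≟ v
  ... | no _  | no _  = cong (_ ∷_) (contractArcs-mapMaybe as)
  ... | yes _ | _     = contractArcs-mapMaybe as
  ... | no _  | yes _ = contractArcs-mapMaybe as

  contractArc-just⁻ : ∀ {a b a′ b′} → contractArc (a , b) ≡ just (a′ , b′) →
    a ≢ u × b ≢ v × a′ ≡ merge u≢v a × b′ ≡ merge u≢v b
  contractArc-just⁻ {a} {b} = go (a ≟ u) (b ≟ v)
    where
    go : ∀ {a′ b′} a≟u b≟v → contractArc′ a b a≟u b≟v ≡ just (a′ , b′) →
      a ≢ u × b ≢ v × a′ ≡ merge u≢v a × b′ ≡ merge u≢v b
    go (no a≢u) (no b≢v) refl = a≢u , b≢v , refl , refl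

  contractArc-just : ∀ {a b} → a ≢ u → b ≢ v → contractArc (a , b) ≡ just (merge u≢v a , merge u≢v b)
  contractArc-just {a} {b} a≢u b≢v = go (a ≟ u) (b ≟ v)
    where
    go : ∀ a≟u b≟v → contractArc′ a b a≟u b≟v ≡ just (merge u≢v a , merge u≢v b)
    go (no _)      (no _)      = refl
    go (yes a≡u)   _           = ⊥-elim (a≢u a≡u)
    go (no _)      (yes b≡v)   = ⊥-elim (b≢v b≡v)

module Contraction {m : ℕ} (as : List (Fin (suc m) × Fin (suc m))) (e : Fin (length as))
  (u≢v : tl (digraph (suc m) as) e ≢ hd (digraph (suc m) as) e) where

  open Merge u≢v public

  D : Digraph
  D = digraph (suc m) as

  u v : Fin (suc m)
  u = tl D e
  v = hd D e

  D/ : Digraph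
  D/ = digraph m (mapMaybe contractArc as)

  original : Arc D/ → Arc D
  original = mapMaybe-index contractArc as

  original-ends : ∀ c → tl D (original c) ≢ u × hd D (original c) ≢ v ×
    tl D/ c ≡ merge u≢v (tl D (original c)) × hd D/ c ≡ merge u≢v (hd D (original c))
  original-ends c = contractArc-just⁻ (lookup-mapMaybe-index contractArc as c)

  tl-contracted : ∀ c → tl D/ c ≡ merge u≢v (tl D (original c))
  tl-contracted c = proj₁ (proj₂ (proj₂ (original-ends c)))

  hd-contracted : ∀ c → hd D/ c ≡ merge u≢v (hd D (original c))
  hd-contracted c = proj₂ (proj₂ (proj₂ (original-ends c)))

  -- Arcs of D/ leaving w come from arcs leaving v and arcs entering w from arcs entering u, since
  -- the arcs leaving u and entering v are deleted.
  tl-original : ∀ c → tl D (original c) ≡ unmerge v (tl D/ c)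
  tl-original c = let tl≢u , _ , tl≡ , _ = original-ends c in
    trans (sym (unmerge-merge-tl tl≢u)) (cong (unmerge _) (sym tl≡))

  hd-original : ∀ c → hd D (original c) ≡ unmerge u (hd D/ c)
  hd-original c = let _ , hd≢v , _ , hd≡ = original-ends c in
    trans (sym (unmerge-merge-hd hd≢v)) (cong (unmerge _) (sym hd≡))

  original≢e : ∀ c → original c ≢ e
  original≢e c eq = proj₁ (original-ends c) (cong (tl D) eq)

  original⁻¹ : ∀ {a} → tl D a ≢ u → hd D a ≢ v → ∃[ c ] original c ≡ a
  original⁻¹ {a} tl≢u hd≢v = let c , eq = mapMaybe-index⁻¹-kept contractArc as a (contractArc-just tl≢u hd≢v) in
    c , mapMaybe-index-index⁻¹ contractArc as a eq

  contraction-embedding : ArcEmbedding D/ D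
  contraction-embedding = mapMaybe-embedding as contractArc (punchIn v) (punchIn-injective _ _ _)
    (avoids? D/ w) lift
    where
    lift : ∀ {c a b} → Avoids D/ w c → contractArc (a , b) ≡ just (lookup (mapMaybe contractArc as) c) →
      punchIn v (tl D/ c) ≡ a × punchIn v (hd D/ c) ≡ b
    lift {c} (tl≢w , hd≢w) eq with _ , b≢v , tl≡ , hd≡ ← contractArc-just⁻ eq =
      trans (cong (punchIn _) tl≡) (punchIn-merge (λ a≡v → tl≢w (trans tl≡ (trans (cong (merge u≢v) a≡v) merge-v)))) ,
      trans (cong (punchIn _) hd≡) (punchIn-merge b≢v)

  -- Puts e back at the first visit of w; `expandFrom d cs` expands cs, which starts at the
  -- vertex tested by d.
  mutual
    expandFrom : ∀ {n x} → Dec (x ≡ w) → Vec (Arc D/) n → Vec (Arc D) (suc n)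
    expandFrom (yes _) cs = e ∷ Vec.map original cs
    expandFrom (no _)  cs = expandTail cs

    expandTail : ∀ {n} → Vec (Arc D/) n → Vec (Arc D) (suc n)
    expandTail []       = e ∷ []
    expandTail (c ∷ cs) = original c ∷ expandFrom (hd D/ c ≟ w) cs

  expand : ∀ {n} → Vec (Arc D/) (suc n) → Vec (Arc D) (suc (suc n))
  expand (c ∷ cs) = expandFrom (tl D/ c ≟ w) (c ∷ cs)

  -- Vertex lists under expansion: the first w becomes u, v (the value on lists without w is junk).
  mutual
    splitFrom : ∀ {x} → Dec (x ≡ w) → List (Fin m) → List (Fin (suc m))
    splitFrom (yes _)    xs = u ∷ v ∷ List.map (unmerge u) xs
    splitFrom {x} (no _) xs = punchIn v x ∷ splitW xs

    splitW : List (Fin m) → List (Fin (suc m))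
    splitW []       = v ∷ []
    splitW (x ∷ xs) = splitFrom (x ≟ w) xs

  heads-map-original : ∀ {n} (cs : Vec (Arc D/) n) → heads D (Vec.map original cs) ≡ List.map (unmerge u) (heads D/ cs)
  heads-map-original []       = refl
  heads-map-original (c ∷ cs) = cong₂ _∷_ (hd-original c) (heads-map-original cs)

  heads-expandTail : ∀ {n} (cs : Vec (Arc D/) n) → heads D (expandTail cs) ≡ splitW (heads D/ cs)
  heads-expandTail []       = refl
  heads-expandTail (c ∷ cs) with hd D/ c ≟ w
  ... | yes hd≡w = cong₂ _∷_ (trans (hd-original c) (unmerge-w hd≡w)) (cong (v ∷_) (heads-map-original cs))
  ... | no hd≢w  = cong₂ _∷_ (trans (hd-original c) (unmerge-≢w hd≢w)) (heads-expandTail cs)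

  vertices-expand : ∀ {n} (cs : Vec (Arc D/) (suc n)) → vertices D (expand cs) ≡ splitW (vertices D/ cs)
  vertices-expand (c ∷ cs) with tl D/ c ≟ w
  ... | yes _    = cong (λ hs → u ∷ v ∷ hs) (heads-map-original (c ∷ cs))
  ... | no tl≢w  = cong₂ _∷_ (trans (tl-original c) (unmerge-≢w tl≢w)) (heads-expandTail (c ∷ cs))

  ∈-splitW⁻ : ∀ {y} xs → y ∈ splitW xs → merge u≢v y ≡ w ⊎ merge u≢v y ∈ xs
  ∈-splitW⁻ []       (here refl) = inj₁ merge-v
  ∈-splitW⁻ (x ∷ xs) y∈ with x ≟ w
  ∈-splitW⁻ (x ∷ xs) (here refl)          | yes _ = inj₁ refl
  ∈-splitW⁻ (x ∷ xs) (there (here refl))  | yes _ = inj₁ merge-v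
  ∈-splitW⁻ (x ∷ xs) (there (there y∈))   | yes _ with z , z∈ , refl ← ∈-map⁻ (unmerge u) y∈ =
    inj₂ (there (subst (_∈ xs) (sym (merge-unmerge-u z)) z∈))
  ∈-splitW⁻ (x ∷ xs) (here refl)          | no _  = inj₂ (here (merge-punchIn x))
  ∈-splitW⁻ (x ∷ xs) (there y∈)           | no _  = Sum.map₂ there (∈-splitW⁻ xs y∈)

  ∈-splitW : ∀ {x} xs → x ∈ xs → x ≢ w → punchIn v x ∈ splitW xs
  ∈-splitW (y ∷ ys) x∈ x≢w with y ≟ w
  ∈-splitW (y ∷ ys) (here refl) x≢w | yes y≡w = ⊥-elim (x≢w y≡w)
  ∈-splitW (y ∷ ys) (there x∈)  x≢w | yes _   =
    there (there (subst (_∈ List.map (unmerge u) ys) (unmerge-≢w x≢w) (∈-map⁺ (unmerge u) x∈)))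
  ∈-splitW (y ∷ ys) (here refl) x≢w | no _    = here refl
  ∈-splitW (y ∷ ys) (there x∈)  x≢w | no _    = there (∈-splitW ys x∈ x≢w)

  private
    ∈-∷-≢ : ∀ {A : Set} {x y : A} {ys} → x ∈ y ∷ ys → y ≢ x → x ∈ ys
    ∈-∷-≢ (here x≡y) y≢x = ⊥-elim (y≢x (sym x≡y))
    ∈-∷-≢ (there x∈) _   = x∈

  splitW-unique : ∀ xs → w ∈ xs → Unique xs → Unique (splitW xs)
  splitW-unique (x ∷ xs) w∈ (x∉ ∷ xs-unique) with x ≟ w
  ... | yes x≡w = (u≢v All.∷ All.tabulate u∉) ∷ All.tabulate v∉ ∷ Unique.map⁺ unmerge-injective xs-unique
    where
    w∉xs : ∀ {z} → z ∈ xs → z ≢ w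
    w∉xs z∈ z≡w = All.lookup x∉ z∈ (trans x≡w (sym z≡w))
    u∉ : ∀ {y} → y ∈ List.map (unmerge u) xs → u ≢ y
    u∉ y∈ u≡y with z , z∈ , refl ← ∈-map⁻ (unmerge u) y∈ =
      w∉xs z∈ (trans (sym (merge-unmerge-u z)) (cong (merge u≢v) (sym u≡y)))
    v∉ : ∀ {y} → y ∈ List.map (unmerge u) xs → v ≢ y
    v∉ y∈ v≡y with z , z∈ , refl ← ∈-map⁻ (unmerge u) y∈ =
      w∉xs z∈ (trans (sym (merge-unmerge-u z)) (trans (cong (merge u≢v) (sym v≡y)) merge-v))
  ... | no x≢w = All.tabulate x′∉ ∷ splitW-unique xs (∈-∷-≢ w∈ x≢w) xs-unique
    where
    x′∉ : ∀ {y} → y ∈ splitW xs → punchIn v x ≢ y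
    x′∉ y∈ x′≡y with ∈-splitW⁻ xs y∈
    ... | inj₁ y↦w = x≢w (trans (sym (merge-punchIn x)) (trans (cong (merge u≢v) x′≡y) y↦w))
    ... | inj₂ y↦∈ = All.lookup x∉ (subst (_∈ xs) (trans (cong (merge u≢v) (sym x′≡y)) (merge-punchIn x)) y↦∈) refl

  splitW-unique⁻ : ∀ xs → w ∈ xs → Unique (splitW xs) → Unique xs
  splitW-unique⁻ (x ∷ xs) w∈ split-unique with x ≟ w
  splitW-unique⁻ (x ∷ xs) w∈ (u∉ ∷ _ ∷ map-unique) | yes x≡w = All.tabulate x∉ ∷ Unique.map⁻ map-unique
    where
    x∉ : ∀ {z} → z ∈ xs → x ≢ z
    x∉ z∈ x≡z = All.lookup u∉ (there (∈-map⁺ (unmerge u) z∈)) (sym (unmerge-w (trans (sym x≡z) x≡w)))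
  splitW-unique⁻ (x ∷ xs) w∈ (x′∉ ∷ split-unique)  | no x≢w =
    All.tabulate x∉ ∷ splitW-unique⁻ xs (∈-∷-≢ w∈ x≢w) split-unique
    where
    x∉ : ∀ {z} → z ∈ xs → x ≢ z
    x∉ z∈ refl = All.lookup x′∉ (∈-splitW xs z∈ x≢w) refl

  original-linked : ∀ {c d} → hd D/ c ≡ tl D/ d → hd D/ c ≢ w → hd D (original c) ≡ tl D (original d)
  original-linked {c} {d} c→d hd≢w = begin
    hd D (original c)        ≡⟨ hd-original c ⟩
    unmerge u (hd D/ c)      ≡⟨ unmerge-≢w hd≢w ⟩
    punchIn v (hd D/ c)      ≡⟨ cong (punchIn v) c→d ⟩
    punchIn v (tl D/ d)      ≡⟨ unmerge-≢w (λ tl≡w → hd≢w (trans c→d tl≡w)) ⟨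
    unmerge v (tl D/ d)      ≡⟨ tl-original d ⟨
    tl D (original d)        ∎
    where open ≡-Reasoning

  original-linked⁻ : ∀ {c d} → hd D (original c) ≡ tl D (original d) → hd D/ c ≡ tl D/ d
  original-linked⁻ {c} {d} c→d = trans (hd-contracted c)
    (trans (cong (merge u≢v) c→d) (sym (tl-contracted d)))

  linked-map-original : ∀ {n} (cs : Vec (Arc D/) n) → Linked D/ cs → w ∉ heads D/ cs → Linked D (Vec.map original cs)
  linked-map-original []           _               _   = tt
  linked-map-original (c ∷ [])     _               _   = tt
  linked-map-original (c ∷ d ∷ ds) (c→d , linked) w∉ =
    original-linked c→d (λ hd≡w → w∉ (here (sym hd≡w))) ,
    linked-map-original (d ∷ ds) linked (λ w∈ → w∉ (there w∈))

  linked-map-original⁻ : ∀ {n} (cs : Vec (Arc D/) n) → Linked D (Vec.map original cs) → Linked D/ cs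
  linked-map-original⁻ []           _               = tt
  linked-map-original⁻ (c ∷ [])     _               = tt
  linked-map-original⁻ (c ∷ d ∷ ds) (c→d , linked) = original-linked⁻ c→d , linked-map-original⁻ (d ∷ ds) linked

  linked-expandTail : ∀ {n} (cs : Vec (Arc D/) n) → Linked D/ cs → w ∈ heads D/ cs → Unique (heads D/ cs) →
    Linked D (expandTail cs)
  linked-expandTail (c ∷ cs) linked w∈ unique with hd D/ c ≟ w
  linked-expandTail (c ∷ [])     _               _  _            | yes hd≡w =
    trans (hd-original c) (unmerge-w hd≡w) , tt
  linked-expandTail (c ∷ d ∷ ds) (c→d , linked) _  (hd∉ ∷ _)    | yes hd≡w =
    trans (hd-original c) (unmerge-w hd≡w) ,
    sym (trans (tl-original d) (unmerge-w (trans (sym c→d) hd≡w))) ,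
    linked-map-original (d ∷ ds) linked (λ w∈ → All.lookup hd∉ w∈ hd≡w)
  linked-expandTail (c ∷ [])     _               (here w≡hd) _   | no hd≢w = ⊥-elim (hd≢w (sym w≡hd))
  linked-expandTail (c ∷ d ∷ ds) (c→d , linked) w∈ (_ ∷ unique) | no hd≢w =
    original-linked c→d hd≢w , linked-expandTail (d ∷ ds) linked (∈-∷-≢ w∈ hd≢w) unique

  linked-expand : ∀ {n} (cs : Vec (Arc D/) (suc n)) → Linked D/ cs → w ∈ vertices D/ cs →
    Unique (vertices D/ cs) → Linked D (expand cs)
  linked-expand (c ∷ cs) linked w∈ unique with tl D/ c ≟ w
  linked-expand (c ∷ cs) linked w∈          (tl∉ ∷ _)    | yes tl≡w =
    sym (trans (tl-original c) (unmerge-w tl≡w)) ,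
    linked-map-original (c ∷ cs) linked (λ w∈ → All.lookup tl∉ w∈ tl≡w)
  linked-expand (c ∷ cs) linked w∈          (_ ∷ unique) | no tl≢w =
    linked-expandTail (c ∷ cs) linked (∈-∷-≢ w∈ tl≢w) unique

  linked-expandTail⁻ : ∀ {n} c (cs : Vec (Arc D/) n) → Linked D (expandTail (c ∷ cs)) →
    Linked D/ (c ∷ cs) × w ∈ heads D/ (c ∷ cs)
  linked-expandTail⁻ c cs linked with hd D/ c ≟ w
  linked-expandTail⁻ c []       _                    | yes hd≡w = tt , here (sym hd≡w)
  linked-expandTail⁻ c (d ∷ ds) (_ , v→d , linked) | yes hd≡w =
    (trans hd≡w (sym (trans (tl-contracted d) (trans (cong (merge u≢v) (sym v→d)) merge-v))) ,
     linked-map-original⁻ (d ∷ ds) linked) , here (sym hd≡w)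
  linked-expandTail⁻ c []       (c→e , _)          | no hd≢w =
    ⊥-elim (hd≢w (trans (hd-contracted c) (cong (merge u≢v) c→e)))
  linked-expandTail⁻ c (d ∷ ds) (c→d , linked)     | no hd≢w =
    let linked′ , w∈ = linked-expandTail⁻ d ds linked in (original-linked⁻ c→d , linked′) , there w∈

  linked-expand⁻ : ∀ {n} (cs : Vec (Arc D/) (suc n)) → Linked D (expand cs) → Linked D/ cs × w ∈ vertices D/ cs
  linked-expand⁻ (c ∷ cs) linked with tl D/ c ≟ w
  linked-expand⁻ (c ∷ cs) (_ , linked) | yes tl≡w = linked-map-original⁻ (c ∷ cs) linked , here (sym tl≡w)
  linked-expand⁻ (c ∷ cs) linked       | no _     = Product.map₂ there (linked-expandTail⁻ c cs linked)

  path-expand : ∀ {n} (cs : Vec (Arc D/) (suc n)) → IsPath D/ cs → w ∈ vertices D/ cs → IsPath D (expand cs)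
  path-expand cs path w∈ = mkPath D
    (linked-expand cs (path-linked D/ path) w∈ (path-unique D/ path))
    (subst Unique (sym (vertices-expand cs)) (splitW-unique (vertices D/ cs) w∈ (path-unique D/ path)))

  path-expand⁻ : ∀ {n} (cs : Vec (Arc D/) (suc n)) → IsPath D (expand cs) → IsPath D/ cs × w ∈ vertices D/ cs
  path-expand⁻ cs path = let linked , w∈ = linked-expand⁻ cs (path-linked D path) in
    mkPath D/ linked (splitW-unique⁻ (vertices D/ cs) w∈ (subst Unique (vertices-expand cs) (path-unique D path))) ,
    w∈

  deleteE : ∀ {n} → Vec (Arc D) (suc n) → Vec (Arc D) n
  deleteE {zero}  (_ ∷ [])  = []
  deleteE {suc n} (a ∷ es) with a ≟ e
  ... | yes _ = es
  ... | no _  = a ∷ deleteE es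

  deleteE-e : ∀ {n} (es : Vec (Arc D) n) → deleteE (e ∷ es) ≡ es
  deleteE-e []      = refl
  deleteE-e (_ ∷ _) with e ≟ e
  ... | yes _   = refl
  ... | no e≢e  = ⊥-elim (e≢e refl)

  deleteE-original : ∀ {n} c (es : Vec (Arc D) (suc n)) → deleteE (original c ∷ es) ≡ original c ∷ deleteE es
  deleteE-original c es with original c ≟ e
  ... | yes c≡e = ⊥-elim (original≢e c c≡e)
  ... | no _    = refl

  mutual
    deleteE-expandFrom : ∀ {n x} (x≟w : Dec (x ≡ w)) (cs : Vec (Arc D/) n) →
      deleteE (expandFrom x≟w cs) ≡ Vec.map original cs
    deleteE-expandFrom (yes _) cs = deleteE-e (Vec.map original cs)
    deleteE-expandFrom (no _)  cs = deleteE-expandTail cs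

    deleteE-expandTail : ∀ {n} (cs : Vec (Arc D/) n) → deleteE (expandTail cs) ≡ Vec.map original cs
    deleteE-expandTail []       = refl
    deleteE-expandTail (c ∷ cs) = trans (deleteE-original c (expandFrom (hd D/ c ≟ w) cs))
      (cong (original c ∷_) (deleteE-expandFrom (hd D/ c ≟ w) cs))

  expand-injective : ∀ {n} {cs cs′ : Vec (Arc D/) (suc n)} → expand cs ≡ expand cs′ → cs ≡ cs′
  expand-injective {cs = c ∷ cs} {c′ ∷ cs′} eq = map-injective original-injective (begin
    Vec.map original (c ∷ cs)    ≡⟨ deleteE-expandFrom (tl D/ c ≟ w) (c ∷ cs) ⟨
    deleteE (expand (c ∷ cs))    ≡⟨ cong deleteE eq ⟩
    deleteE (expand (c′ ∷ cs′))  ≡⟨ deleteE-expandFrom (tl D/ c′ ≟ w) (c′ ∷ cs′) ⟩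
    Vec.map original (c′ ∷ cs′)  ∎)
    where
    open ≡-Reasoning
    original-injective : ∀ {c c′} → original c ≡ original c′ → c ≡ c′
    original-injective {c} {c′} eq′ = just-injective (trans (sym (mapMaybe-index⁻¹-index contractArc as c))
      (trans (cong (mapMaybe-index⁻¹ contractArc as) eq′) (mapMaybe-index⁻¹-index contractArc as c′)))

  mutual
    expandFrom-via-e : ∀ {n x} (x≟w : Dec (x ≡ w)) (cs : Vec (Arc D/) n) → ¬ AllV.All (_≢ e) (expandFrom x≟w cs)
    expandFrom-via-e (yes _) cs (e≢e ∷ _) = e≢e refl
    expandFrom-via-e (no _)  cs avoid     = expandTail-via-e cs avoid

    expandTail-via-e : ∀ {n} (cs : Vec (Arc D/) n) → ¬ AllV.All (_≢ e) (expandTail cs)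
    expandTail-via-e []       (e≢e ∷ _)  = e≢e refl
    expandTail-via-e (c ∷ cs) (_ ∷ avoid) = expandFrom-via-e (hd D/ c ≟ w) cs avoid

  expand-via-e : ∀ {n} (cs : Vec (Arc D/) (suc n)) → ¬ AllV.All (_≢ e) (expand cs)
  expand-via-e (c ∷ cs) = expandFrom-via-e (tl D/ c ≟ w) (c ∷ cs)

  module _ {k} {es : Vec (Arc D) k} (path : IsPath D es) (e∈ : e ∈ toList es) where

    path-via-e-ends : ∀ {x} → x ∈ toList es → x ≢ e → tl D x ≢ u × hd D x ≢ v
    path-via-e-ends x∈ x≢e = (λ tl≡u → x≢e (path-tl-injective D path x∈ e∈ tl≡u))
                           , (λ hd≡v → x≢e (path-hd-injective D path x∈ e∈ hd≡v))

  originals⁻¹ : ∀ {n} (xs : Vec (Arc D) n) → (∀ {x} → x ∈ toList xs → tl D x ≢ u × hd D x ≢ v) →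
    ∃[ cs ] Vec.map original cs ≡ xs
  originals⁻¹ []       _    = [] , refl
  originals⁻¹ (x ∷ xs) ends =
    let c , c↦x = original⁻¹ (proj₁ (ends (here refl))) (proj₂ (ends (here refl)))
        cs , cs↦xs = originals⁻¹ xs (λ x∈ → ends (there x∈))
    in c ∷ cs , cong₂ _∷_ c↦x cs↦xs

  expandTail-surjective : ∀ {n a} {es : Vec (Arc D) n} → IsPath D (a ∷ es) → a ≢ e → e ∈ toList es →
    ∃[ cs ] expandTail cs ≡ a ∷ es
  expandTail-surjective {es = b ∷ bs} path a≢e e∈
    with ends ← path-via-e-ends path (there e∈)
    with c , refl ← original⁻¹ (proj₁ (ends (here refl) a≢e)) (proj₂ (ends (here refl) a≢e))
    with b ≟ e
  ... | yes refl with cs , refl ← originals⁻¹ bs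
                       (λ x∈ → ends (there (there x∈)) (path-first-∉-rest D (path-∷⁻ D path) x∈)) =
    c ∷ cs , expandTail-c∷cs
    where
    expandTail-c∷cs : expandTail (c ∷ cs) ≡ original c ∷ e ∷ Vec.map original cs
    expandTail-c∷cs with hd D/ c ≟ w
    ... | yes _    = refl
    ... | no hd≢w  = ⊥-elim (hd≢w (trans (hd-contracted c) (cong (merge u≢v) (proj₁ (proj₁ path)))))
  ... | no b≢e with cs , cs↦b∷bs ← expandTail-surjective (path-∷⁻ D path) b≢e (∈-∷-≢ e∈ b≢e) =
    c ∷ cs , expandTail-c∷cs
    where
    expandTail-c∷cs : expandTail (c ∷ cs) ≡ original c ∷ b ∷ bs
    expandTail-c∷cs with hd D/ c ≟ w
    ... | no _     = cong (original c ∷_) cs↦b∷bs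
    ... | yes hd≡w with merge≡w⁻ (trans (sym (hd-contracted c)) hd≡w)
    ...   | inj₁ hd≡u = ⊥-elim (proj₁ (ends (there (here refl)) b≢e) (trans (sym (proj₁ (proj₁ path))) hd≡u))
    ...   | inj₂ hd≡v = ⊥-elim (proj₂ (ends (here refl) a≢e) hd≡v)

  expand-surjective : ∀ {n} {es : Vec (Arc D) (suc (suc n))} → IsPath D es → e ∈ toList es →
    ∃[ cs ] expand cs ≡ es
  expand-surjective {es = a ∷ b ∷ bs} path e∈ with a ≟ e
  ... | yes refl
    with c ∷ cs , refl ← originals⁻¹ (b ∷ bs)
                           (λ x∈ → path-via-e-ends path e∈ (there x∈) (path-first-∉-rest D path x∈))
    = c ∷ cs , expand-c∷cs
    where
    expand-c∷cs : expand (c ∷ cs) ≡ e ∷ Vec.map original (c ∷ cs)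
    expand-c∷cs with tl D/ c ≟ w
    ... | yes _    = refl
    ... | no tl≢w  =
      ⊥-elim (tl≢w (trans (tl-contracted c) (trans (cong (merge u≢v) (sym (proj₁ (proj₁ path)))) merge-v)))
  ... | no a≢e with c ∷ cs , c∷cs↦a∷es ← expandTail-surjective path a≢e (∈-∷-≢ e∈ a≢e) =
    c ∷ cs , expand-c∷cs
    where
    c↦a : original c ≡ a
    c↦a = ∷-injectiveˡ c∷cs↦a∷es
    expand-c∷cs : expand (c ∷ cs) ≡ a ∷ b ∷ bs
    expand-c∷cs with tl D/ c ≟ w
    ... | no _     = c∷cs↦a∷es
    ... | yes tl≡w with merge≡w⁻ (trans (sym (tl-contracted c)) tl≡w)
    ...   | inj₁ tl≡u = ⊥-elim (proj₁ (path-via-e-ends path e∈ (here refl) a≢e) (trans (cong (tl D) (sym c↦a)) tl≡u))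
    ...   | inj₂ tl≡v = ⊥-elim (path-start-∉-heads D path
                          (subst (_∈ heads D (a ∷ b ∷ bs)) (sym (trans (cong (tl D) (sym c↦a)) tl≡v)) (hd∈heads D e∈)))

  private
    ¬all-≢⇒∈ : ∀ {n} (es : Vec (Arc D) n) → ¬ AllV.All (_≢ e) es → e ∈ toList es
    ¬all-≢⇒∈ []       ¬all = ⊥-elim (¬all [])
    ¬all-≢⇒∈ (a ∷ es) ¬all with a ≟ e
    ... | yes a≡e = here (sym a≡e)
    ... | no a≢e  = there (¬all-≢⇒∈ es (λ all → ¬all (a≢e ∷ all)))

  #pathsVia-contraction : ∀ k → #pathsNotAll D/ (avoids? D/ w) (suc k) ≡ #pathsVia D e (suc (suc k))
  #pathsVia-contraction k = #seqs-bijection D/ D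
    (isPath? D/ ∩? ∁? (all? (avoids? D/ w))) (isPath? D ∩? ∁? (all? (λ a → ¬? (a ≟ e)))) expand
    (λ {cs} (path , ¬avoids) →
      path-expand cs path (¬avoids⇒∈vertices D/ (path-linked D/ path) ¬avoids) , expand-via-e cs)
    (λ _ _ → expand-injective)
    λ {es} (path , ¬avoids) → let cs , cs↦es = expand-surjective path (¬all-≢⇒∈ es ¬avoids)
                                  path′ , w∈ = path-expand⁻ cs (subst (IsPath D) (sym cs↦es) path)
                              in cs , (path′ , ∈vertices⇒¬avoids D/ w∈) , cs↦es

-- Deletion–contraction

module NonLoopArc {m : ℕ} (as : List (Fin (suc (suc m)) × Fin (suc (suc m)))) (e : Fin (length as))
  (u≢v : tl (digraph (suc (suc m)) as) e ≢ hd (digraph (suc (suc m)) as) e) where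

  open Contraction as e u≢v public

  AvoidsBoth : Pred (Arc D) _
  AvoidsBoth a = Avoids D u a × Avoids D v a

  avoidsBoth? : Decidable AvoidsBoth
  avoidsBoth? = avoids? D u ∩? avoids? D v

  contraction-keptImage : KeptImage contraction-embedding ≐ AvoidsBoth
  contraction-keptImage = kept⇒avoids , avoids⇒kept
    where
    kept⇒avoids : ∀ {a} → KeptImage contraction-embedding a → AvoidsBoth a
    kept⇒avoids {a} (c , c↤a , tl≢w , hd≢w) with refl ← mapMaybe-index-index⁻¹ contractArc as a c↤a =
      let tl≢u , hd≢v , tl≡ , hd≡ = original-ends c in
      (tl≢u , (λ hd≡u → hd≢w (trans hd≡ (cong (merge u≢v) hd≡u)))) ,
      ((λ tl≡v → tl≢w (trans tl≡ (trans (cong (merge u≢v) tl≡v) merge-v))) , hd≢v)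
    avoids⇒kept : ∀ {a} → AvoidsBoth a → KeptImage contraction-embedding a
    avoids⇒kept {a} ((tl≢u , hd≢u) , (tl≢v , hd≢v))
      with c , c↤a ← mapMaybe-index⁻¹-kept contractArc as a (contractArc-just tl≢u hd≢v)
      with refl ← mapMaybe-index-index⁻¹ contractArc as a c↤a =
      let _ , _ , tl≡ , hd≡ = original-ends c in
      c , c↤a ,
      (λ tl≡w → [ tl≢u , tl≢v ]′ (merge≡w⁻ (trans (sym tl≡) tl≡w))) ,
      (λ hd≡w → [ hd≢u , hd≢v ]′ (merge≡w⁻ (trans (sym hd≡) hd≡w)))

  v′ : Fin (suc m)
  v′ = punchOut u≢v

  D₁ : Digraph
  D₁ = digraph (suc m) (mapMaybe (avoid u) as)

  D₂ : Digraph
  D₂ = digraph m (mapMaybe (avoid v′) (mapMaybe (avoid u) as))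

  E₂ : ArcEmbedding D₂ D₁
  E₂ = deleteVertex-embedding v′ (mapMaybe (avoid u) as) U?

  E₁ : ArcEmbedding D₁ D
  E₁ = deleteVertex-embedding u as (keptImage? E₂)

  double-deletion-keptImage : KeptImage E₁ ≐ AvoidsBoth
  double-deletion-keptImage = kept⇒avoids , avoids⇒kept
    where
    kept⇒avoids : ∀ {a} → KeptImage E₁ a → AvoidsBoth a
    kept⇒avoids {a} (c₁ , c₁↤a , c₂ , c₂↤c₁ , _)
      with refl ← mapMaybe-index-index⁻¹ (avoid u) as a c₁↤a
      with refl ← mapMaybe-index-index⁻¹ (avoid v′) (mapMaybe (avoid u) as) c₁ c₂↤c₁ =
      let u≢tl , u≢hd , tl≡ , hd≡ = avoid-just⁻ u (lookup-mapMaybe-index (avoid u) as c₁)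
          v′≢tl₁ , v′≢hd₁ , _ , _ = avoid-just⁻ v′ (lookup-mapMaybe-index (avoid v′) (mapMaybe (avoid u) as) c₂)
      in (≢-sym u≢tl , ≢-sym u≢hd) ,
         ((λ tl≡v → v′≢tl₁ (punchIn-injective u _ _ (trans (punchIn-punchOut u≢v) (sym (trans tl≡ tl≡v))))) ,
          (λ hd≡v → v′≢hd₁ (punchIn-injective u _ _ (trans (punchIn-punchOut u≢v) (sym (trans hd≡ hd≡v))))))
    avoids⇒kept : ∀ {a} → AvoidsBoth a → KeptImage E₁ a
    avoids⇒kept {a} ((tl≢u , hd≢u) , (tl≢v , hd≢v))
      with c₁ , c₁↤a ← mapMaybe-index⁻¹-kept (avoid u) as a (proj₂ (avoid-just u (≢-sym tl≢u) (≢-sym hd≢u)))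
      with refl ← mapMaybe-index-index⁻¹ (avoid u) as a c₁↤a =
      let _ , _ , tl≡ , hd≡ = avoid-just⁻ u (lookup-mapMaybe-index (avoid u) as c₁)
          v′≢ : ∀ {x} → punchIn u x ≢ v → v′ ≢ x
          v′≢ x≢v v′≡x = x≢v (trans (cong (punchIn u) (sym v′≡x)) (punchIn-punchOut u≢v))
          c₂ , c₂↤c₁ = mapMaybe-index⁻¹-kept (avoid v′) (mapMaybe (avoid u) as) c₁
            (proj₂ (avoid-just v′ (v′≢ (λ eq → tl≢v (trans (sym tl≡) eq))) (v′≢ (λ eq → hd≢v (trans (sym hd≡) eq)))))
      in c₁ , c₁↤a , c₂ , c₂↤c₁ , tt

  p-deleteBoth : ∀ k → p k D₂ ≡ #pathsAll D avoidsBoth? k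
  p-deleteBoth k = begin
    p k D₂                            ≡⟨ p≡#pathsAll-U D₂ k ⟩
    #pathsAll D₂ U? k                 ≡⟨ #pathsAll-embedding E₂ k ⟩
    #pathsAll D₁ (keptImage? E₂) k    ≡⟨ #pathsAll-embedding E₁ k ⟩
    #pathsAll D (keptImage? E₁) k     ≡⟨ #pathsAll-cong D (keptImage? E₁) avoidsBoth? double-deletion-keptImage k ⟩
    #pathsAll D avoidsBoth? k         ∎
    where open ≡-Reasoning

  p-contracted : ∀ k → p (suc k) D/ ≡ p (suc k) D₂ + #pathsVia D e (suc (suc k))
  p-contracted k = begin
    p (suc k) D/
      ≡⟨ p≡#pathsAll+#pathsNotAll D/ (avoids? D/ w) (suc k) ⟩
    #pathsAll D/ (avoids? D/ w) (suc k) + #pathsNotAll D/ (avoids? D/ w) (suc k)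
      ≡⟨ cong₂ _+_ avoiding-w (#pathsVia-contraction k) ⟩
    p (suc k) D₂ + #pathsVia D e (suc (suc k))
      ∎
    where
    open ≡-Reasoning
    avoiding-w : #pathsAll D/ (avoids? D/ w) (suc k) ≡ p (suc k) D₂
    avoiding-w = begin
      #pathsAll D/ (avoids? D/ w) (suc k)
        ≡⟨ #pathsAll-embedding contraction-embedding (suc k) ⟩
      #pathsAll D (keptImage? contraction-embedding) (suc k)
        ≡⟨ #pathsAll-cong D _ avoidsBoth? contraction-keptImage (suc k) ⟩
      #pathsAll D avoidsBoth? (suc k)
        ≡⟨ p-deleteBoth (suc k) ⟨
      p (suc k) D₂
        ∎

p-contract : ∀ D e → ¬ IsLoop D e → ∀ k →
  p (suc k) (D /ₑ e) ≡ p (suc k) (D †ₑ e) + #pathsVia D e (suc (suc k))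
p-contract (digraph zero as) e _ _ = ⊥-elim (¬Fin0 (tl (digraph zero as) e))
p-contract (digraph (suc zero) as) e ¬loop _ = ⊥-elim (¬loop (single-vertex _ _))
  where
  single-vertex : (x y : Fin 1) → x ≡ y
  single-vertex zero zero = refl
p-contract D@(digraph (suc (suc m)) as) e ¬loop k with tl D e ≟ hd D e
... | yes loop = ⊥-elim (¬loop loop)
... | no u≢v   = begin
  p (suc k) (digraph (suc m) (contractArcs u≢v as))
    ≡⟨ cong (λ bs → p (suc k) (digraph (suc m) bs)) (Merge.contractArcs-mapMaybe u≢v as) ⟩
  p (suc k) D/
    ≡⟨ p-contracted k ⟩
  p (suc k) D₂ + #pathsVia D e (suc (suc k))
    ≡⟨ cong (λ bs → p (suc k) (digraph m bs) + #pathsVia D e (suc (suc k))) deleted-arcs ⟨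
  p (suc k) (digraph m (delV v′ (delV u as))) + #pathsVia D e (suc (suc k))
    ∎
  where
  open ≡-Reasoning
  open NonLoopArc as e u≢v hiding (D)
  deleted-arcs : delV v′ (delV u as) ≡ mapMaybe (avoid v′) (mapMaybe (avoid u) as)
  deleted-arcs = trans (cong (delV v′) (delV-mapMaybe u as)) (delV-mapMaybe v′ (mapMaybe (avoid u) as))

p-deleteLoop : ∀ D e → IsLoop D e → ∀ k → p k D ≡ p k (D -ₑ e)
p-deleteLoop D e loop k = begin
  p k D                              ≡⟨ p-deleteArc D e k ⟩
  p k (D -ₑ e) + #pathsVia D e k     ≡⟨ cong (λ n → p k (D -ₑ e) + n) (#pathsVia-loop D e loop k) ⟩
  p k (D -ₑ e) + 0                   ≡⟨ +-identityʳ _ ⟩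
  p k (D -ₑ e)                       ∎
  where open ≡-Reasoning

higher-coefficient : ∀ a b c → + (a + c) ≡ ((+ a ℤ.+ + (b + c)) ℤ.- + b) ℤ.+ + 0
higher-coefficient a b c = begin
  + (a + c)                               ≡⟨ pos-+ a c ⟩
  + a ℤ.+ + c
    ≡⟨ solve 3 (λ x y z → x :+ z := ((x :+ (y :+ z)) :- y) :+ con (+ 0)) refl (+ a) (+ b) (+ c) ⟩
  ((+ a ℤ.+ (+ b ℤ.+ + c)) ℤ.- + b) ℤ.+ + 0 ≡⟨ cong (λ n → ((+ a ℤ.+ n) ℤ.- + b) ℤ.+ + 0) (pos-+ b c) ⟨
  ((+ a ℤ.+ + (b + c)) ℤ.- + b) ℤ.+ + 0   ∎
  where open ≡-Reasoning

linear-coefficient : ∀ a → + (a + 1) ≡ ((+ a ℤ.+ + 0) ℤ.- + 0) ℤ.+ + 1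
linear-coefficient a = trans (pos-+ a 1)
  (solve 1 (λ x → x :+ con (+ 1) := ((x :+ con (+ 0)) :- con (+ 0)) :+ con (+ 1)) refl (+ a))

theorem2p2 : (D : Digraph) (e : Arc D) →
    (IsLoop D e → π D ≗ π (D -ₑ e)) ×
    (¬ IsLoop D e → π D ≗ π (D -ₑ e) ⊕ x· (π (D /ₑ e)) ⊖ x· (π (D †ₑ e)) ⊕ xPoly)
theorem2p2 D e = deleteLoop , deletion-contraction
  where
  open ≡-Reasoning
  deleteLoop : IsLoop D e → π D ≗ π (D -ₑ e)
  deleteLoop _    zero    = refl
  deleteLoop loop (suc k) = cong +_ (p-deleteLoop D e loop (suc k))
  deletion-contraction : ¬ IsLoop D e → π D ≗ π (D -ₑ e) ⊕ x· (π (D /ₑ e)) ⊖ x· (π (D †ₑ e)) ⊕ xPoly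
  deletion-contraction _     zero          = refl
  deletion-contraction ¬loop (suc zero)    = begin
    + p 1 D
      ≡⟨ cong +_ (trans (p-deleteArc D e 1) (cong (λ n → p 1 (D -ₑ e) + n) (#pathsVia-1 D e ¬loop))) ⟩
    + (p 1 (D -ₑ e) + 1)
      ≡⟨ linear-coefficient _ ⟩
    _ ∎
  deletion-contraction ¬loop (suc (suc k)) = begin
    + p (2 + k) D
      ≡⟨ cong +_ (p-deleteArc D e (2 + k)) ⟩
    + (p (2 + k) (D -ₑ e) + #pathsVia D e (2 + k))
      ≡⟨ higher-coefficient (p (2 + k) (D -ₑ e)) (p (1 + k) (D †ₑ e)) (#pathsVia D e (2 + k)) ⟩
    ((+ p (2 + k) (D -ₑ e) ℤ.+ + (p (1 + k) (D †ₑ e) + #pathsVia D e (2 + k))) ℤ.- + p (1 + k) (D †ₑ e)) ℤ.+ + 0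
      ≡⟨ cong (λ n → ((+ p (2 + k) (D -ₑ e) ℤ.+ + n) ℤ.- + p (1 + k) (D †ₑ e)) ℤ.+ + 0) (p-contract D e ¬loop k) ⟨
    ((+ p (2 + k) (D -ₑ e) ℤ.+ + p (1 + k) (D /ₑ e)) ℤ.- + p (1 + k) (D †ₑ e)) ℤ.+ + 0
      ∎
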